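{- Let an instance of one of the CPRHL rules (Axiom, Cons, Assign, Or, While) have conclusion $\{P\}\,C\,\{Q\}$. Suppose there are a natural number $n$ and states $\sigma,\sigma'$ with $\sigma'\models Q$, $\langle C,\sigma\rangle\to^{n}\langle\varepsilon,\sigma'\rangle$ and $\sigma\not\models P$. Then there is a premise $\{P'\}\,C'\,\{Q'\}$ of this rule instance such that $\sigma'\models Q'$ and there exist a natural number $n'\le n$ and a state $\sigma''$ with $\sigma''\not\models P'$ and $\langle C',\sigma''\rangle\to^{n'}\langle\varepsilon,\sigma'\rangle$. Moreover, if the rule is not Cons, then $n'<n$.
   Context: States $\sigma:\mathrm{Var}\to\mathbb{N}$; expressions $E ::= x\mid n\mid f(E,\dots,E)$; Boolean conditions $B ::= Q(E,\dots,E)\mid E=E\mid E\le E\mid\neg B\mid B\wedge B\mid B\vee B$; programs $C ::= \varepsilon\mid C'$, $C' ::= x:=E\mid C';C'\mid\mathtt{while}\ B\ \mathtt{do}\ C\mid C\ \mathtt{or}\ C$ ($\varepsilon$ the empty program; $C_0;C_1$ denotes $C_i$ when $C_{1-i}=\varepsilon$); assertions are first-order formulas over Boolean conditions interpreted over $\mathbb{N}$; $P\models Q$ is semantic entailment; $P[x:=E]$ is substitution. Small-step semantics: $\langle x:=E,\sigma\rangle\to\langle\varepsilon,\sigma[x\mapsto[\![E]\!]\sigma]\rangle$; $\langle\mathtt{while}\ B\ \mathtt{do}\ C,\sigma\rangle\to\langle C;\mathtt{while}\ B\ \mathtt{do}\ C,\sigma\rangle$ if $B$ holds in $\sigma$,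 else $\to\langle\varepsilon,\sigma\rangle$; $\langle C_0;C_1,\sigma\rangle\to\langle C_0';C_1,\sigma'\rangle$ if $\langle C_0,\sigma\rangle\to\langle C_0',\sigma'\rangle$; $\langle C_0\ \mathtt{or}\ C_1,\sigma\rangle\to\langle C_i,\sigma\rangle$ ($i=0,1$); $\to^{n}$ denotes exactly $n$ steps. The CPRHL rules on triples $\{P\}C\{Q\}$: (Axiom) $\{Q\}\,\varepsilon\,\{Q\}$ with no premise; (Cons) from $\{P'\}C\{Q'\}$ infer $\{P\}C\{Q\}$ provided $P'\models P$ and $Q\models Q'$; (Assign) from $\{P\}C\{Q\}$ infer $\{P[x:=E]\}\,x:=E;C\,\{Q\}$; (Or) from $\{P\}C_0;C\{Q\}$ and $\{P\}C_1;C\{Q\}$ infer $\{P\}\,(C_0\ \mathtt{or}\ C_1);C\,\{Q\}$; (While) from $\{\neg B\to P\}C'\{Q\}$ and $\{B\to P\}\,C;\mathtt{while}\ B\ \mathtt{do}\ C;C'\,\{Q\}$ infer $\{P\}\,\mathtt{while}\ B\ \mathtt{do}\ C;C'\,\{Q\}$. -}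

module Defs where

open import Data.Nat using (ℕ; zero; suc; _≟_; _≤_)
open import Data.Fin using (Fin; zero; suc)
open import Data.Vec using (Vec; []; _∷_)
open import Data.Bool using (Bool; T; if_then_else_)
open import Data.List using (List; []; _∷_)
open import Data.Product using (_×_; _,_; Σ)
open import Data.Sum using (_⊎_)
open import Relation.Nullary using (¬_)
open import Relation.Nullary.Decidable using (⌊_⌋)
open import Relation.Binary.PropositionalEquality using (_≡_)

record Signature : Set₁ where
  field
    Fun  : ℕ → Set
    Pred : ℕ → Set
    ⟦_⟧f : ∀ {k} → Fun k → Vec ℕ k → ℕ
    ⟦_⟧p : ∀ {k} → Pred k → Vec ℕ k → Bool

Var : Set
Var = ℕ

State : Set
State = Var → ℕ

_[_↦_] : State → Var → ℕ → State
(σ [ x ↦ v ]) y = if ⌊ x ≟ y ⌋ then v else σ y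

module CPRHL (S : Signature) where
  open Signature S

  data Exp : Set where
    var : Var → Exp
    num : ℕ → Exp
    app : ∀ {k} → Fun k → Vec Exp k → Exp

  mutual
    evalE : Exp → State → ℕ
    evalE (var x) σ = σ x
    evalE (num n) σ = n
    evalE (app f es) σ = ⟦ f ⟧f (evalEs es σ)

    evalEs : ∀ {k} → Vec Exp k → State → Vec ℕ k
    evalEs [] σ = []
    evalEs (e ∷ es) σ = evalE e σ ∷ evalEs es σ

  data Cond : Set where
    pred : ∀ {k} → Pred k → Vec Exp k → Cond
    _=ᶜ_ : Exp → Exp → Cond
    _≤ᶜ_ : Exp → Exp → Cond
    ¬ᶜ_  : Cond → Cond
    _∧ᶜ_ : Cond → Cond → Cond
    _∨ᶜ_ : Cond → Cond → Cond

  holds : Cond → State → Set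
  holds (pred Q es) σ = T (⟦ Q ⟧p (evalEs es σ))
  holds (e₁ =ᶜ e₂) σ = evalE e₁ σ ≡ evalE e₂ σ
  holds (e₁ ≤ᶜ e₂) σ = evalE e₁ σ ≤ evalE e₂ σ
  holds (¬ᶜ B) σ = ¬ holds B σ
  holds (B₁ ∧ᶜ B₂) σ = holds B₁ σ × holds B₂ σ
  holds (B₁ ∨ᶜ B₂) σ = holds B₁ σ ⊎ holds B₂ σ

  -- Terms may mention program
  -- variables (free) and bound variables (de Bruijn indices, Fin k where
  -- k is the number of enclosing quantifiers).  An assertion is a closed
  -- formula, i.e. an element of Assn 0 (its only free variables are
  -- program variables).
  data Term (k : ℕ) : Set where
    pvar : Var → Term k
    bvar : Fin k → Term k
    num  : ℕ → Term k
    app  : ∀ {j} → Fun j → Vec (Term k) j → Term k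

  data Fml (k : ℕ) : Set where
    pred : ∀ {j} → Pred j → Vec (Term k) j → Fml k
    _=ᵃ_ : Term k → Term k → Fml k
    _≤ᵃ_ : Term k → Term k → Fml k
    ¬ᵃ_  : Fml k → Fml k
    _∧ᵃ_ : Fml k → Fml k → Fml k
    _∨ᵃ_ : Fml k → Fml k → Fml k
    _⇒ᵃ_ : Fml k → Fml k → Fml k
    ∀ᵃ   : Fml (suc k) → Fml k
    ∃ᵃ   : Fml (suc k) → Fml k

  Assn : Set
  Assn = Fml 0

  mutual
    ⌈_⌉e : ∀ {k} → Exp → Term k
    ⌈ var x ⌉e = pvar x
    ⌈ num n ⌉e = num n
    ⌈ app f es ⌉e = app f ⌈ es ⌉es

    ⌈_⌉es : ∀ {k j} → Vec Exp j → Vec (Term k) j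
    ⌈ [] ⌉es = []
    ⌈ e ∷ es ⌉es = ⌈ e ⌉e ∷ ⌈ es ⌉es

  ⌈_⌉ : ∀ {k} → Cond → Fml k
  ⌈ pred Q es ⌉ = pred Q ⌈ es ⌉es
  ⌈ e₁ =ᶜ e₂ ⌉ = ⌈ e₁ ⌉e =ᵃ ⌈ e₂ ⌉e
  ⌈ e₁ ≤ᶜ e₂ ⌉ = ⌈ e₁ ⌉e ≤ᵃ ⌈ e₂ ⌉e
  ⌈ ¬ᶜ B ⌉ = ¬ᵃ ⌈ B ⌉
  ⌈ B₁ ∧ᶜ B₂ ⌉ = ⌈ B₁ ⌉ ∧ᵃ ⌈ B₂ ⌉
  ⌈ B₁ ∨ᶜ B₂ ⌉ = ⌈ B₁ ⌉ ∨ᵃ ⌈ B₂ ⌉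

  extend : ∀ {k} → ℕ → (Fin k → ℕ) → Fin (suc k) → ℕ
  extend v ρ zero = v
  extend v ρ (suc i) = ρ i

  mutual
    evalT : ∀ {k} → Term k → State → (Fin k → ℕ) → ℕ
    evalT (pvar x) σ ρ = σ x
    evalT (bvar i) σ ρ = ρ i
    evalT (num n) σ ρ = n
    evalT (app f ts) σ ρ = ⟦ f ⟧f (evalTs ts σ ρ)

    evalTs : ∀ {k j} → Vec (Term k) j → State → (Fin k → ℕ) → Vec ℕ j
    evalTs [] σ ρ = []
    evalTs (t ∷ ts) σ ρ = evalT t σ ρ ∷ evalTs ts σ ρ

  sat : ∀ {k} → Fml k → State → (Fin k → ℕ) → Set
  sat (pred Q ts) σ ρ = T (⟦ Q ⟧p (evalTs ts σ ρ))
  sat (t₁ =ᵃ t₂) σ ρ = evalT t₁ σ ρ ≡ evalT t₂ σ ρ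
  sat (t₁ ≤ᵃ t₂) σ ρ = evalT t₁ σ ρ ≤ evalT t₂ σ ρ
  sat (¬ᵃ φ) σ ρ = ¬ sat φ σ ρ
  sat (φ ∧ᵃ ψ) σ ρ = sat φ σ ρ × sat ψ σ ρ
  sat (φ ∨ᵃ ψ) σ ρ = sat φ σ ρ ⊎ sat ψ σ ρ
  sat (φ ⇒ᵃ ψ) σ ρ = sat φ σ ρ → sat ψ σ ρ
  sat (∀ᵃ φ) σ ρ = (v : ℕ) → sat φ σ (extend v ρ)
  sat (∃ᵃ φ) σ ρ = Σ ℕ λ v → sat φ σ (extend v ρ)

  noBound : Fin 0 → ℕ
  noBound ()

  _⊨_ : State → Assn → Set
  σ ⊨ P = sat P σ noBound

  _⊨ᵉ_ : Assn → Assn → Set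
  P ⊨ᵉ Q = ∀ σ → σ ⊨ P → σ ⊨ Q

  -- Substitution P[x := E] (capture-free: E has no bound variables)
  mutual
    substT : ∀ {k} → Term k → Var → Exp → Term k
    substT (pvar y) x E = if ⌊ x ≟ y ⌋ then ⌈ E ⌉e else pvar y
    substT (bvar i) x E = bvar i
    substT (num n) x E = num n
    substT (app f ts) x E = app f (substTs ts x E)

    substTs : ∀ {k j} → Vec (Term k) j → Var → Exp → Vec (Term k) j
    substTs [] x E = []
    substTs (t ∷ ts) x E = substT t x E ∷ substTs ts x E

  _[_≔_] : ∀ {k} → Fml k → Var → Exp → Fml k
  pred Q ts [ x ≔ E ] = pred Q (substTs ts x E)
  (t₁ =ᵃ t₂) [ x ≔ E ] = substT t₁ x E =ᵃ substT t₂ x E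
  (t₁ ≤ᵃ t₂) [ x ≔ E ] = substT t₁ x E ≤ᵃ substT t₂ x E
  (¬ᵃ φ) [ x ≔ E ] = ¬ᵃ (φ [ x ≔ E ])
  (φ ∧ᵃ ψ) [ x ≔ E ] = (φ [ x ≔ E ]) ∧ᵃ (ψ [ x ≔ E ])
  (φ ∨ᵃ ψ) [ x ≔ E ] = (φ [ x ≔ E ]) ∨ᵃ (ψ [ x ≔ E ])
  (φ ⇒ᵃ ψ) [ x ≔ E ] = (φ [ x ≔ E ]) ⇒ᵃ (ψ [ x ≔ E ])
  ∀ᵃ φ [ x ≔ E ] = ∀ᵃ (φ [ x ≔ E ])
  ∃ᵃ φ [ x ≔ E ] = ∃ᵃ (φ [ x ≔ E ])

  mutual
    data Cmd : Set where
      _≔_      : Var → Exp → Cmd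
      _︔_      : Cmd → Cmd → Cmd
      while_⟳_ : Cond → Prog → Cmd
      _or_      : Prog → Prog → Cmd

    data Prog : Set where
      ε   : Prog
      ⌜_⌝ : Cmd → Prog

  _⨾_ : Prog → Prog → Prog
  ε ⨾ C = C
  ⌜ c ⌝ ⨾ ε = ⌜ c ⌝
  ⌜ c₀ ⌝ ⨾ ⌜ c₁ ⌝ = ⌜ c₀ ︔ c₁ ⌝

  data ⟨_,_⟩⟶⟨_,_⟩ : Prog → State → Prog → State → Set where
    assign : ∀ {x E σ} →
      ⟨ ⌜ x ≔ E ⌝ , σ ⟩⟶⟨ ε , σ [ x ↦ evalE E σ ] ⟩
    whileT : ∀ {B C σ} → holds B σ →
      ⟨ ⌜ while B ⟳ C ⌝ , σ ⟩⟶⟨ C ⨾ ⌜ while B ⟳ C ⌝ , σ ⟩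
    whileF : ∀ {B C σ} → ¬ holds B σ →
      ⟨ ⌜ while B ⟳ C ⌝ , σ ⟩⟶⟨ ε , σ ⟩
    seq : ∀ {c₀ c₁ C₀' σ σ'} → ⟨ ⌜ c₀ ⌝ , σ ⟩⟶⟨ C₀' , σ' ⟩ →
      ⟨ ⌜ c₀ ︔ c₁ ⌝ , σ ⟩⟶⟨ C₀' ⨾ ⌜ c₁ ⌝ , σ' ⟩
    orL : ∀ {C₀ C₁ σ} → ⟨ ⌜ C₀ or C₁ ⌝ , σ ⟩⟶⟨ C₀ , σ ⟩
    orR : ∀ {C₀ C₁ σ} → ⟨ ⌜ C₀ or C₁ ⌝ , σ ⟩⟶⟨ C₁ , σ ⟩

  data ⟨_,_⟩⟶[_]⟨_,_⟩ : Prog → State → ℕ → Prog → State → Set where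
    done : ∀ {C σ} → ⟨ C , σ ⟩⟶[ zero ]⟨ C , σ ⟩
    step : ∀ {C σ C' σ' C'' σ'' n} →
      ⟨ C , σ ⟩⟶⟨ C' , σ' ⟩ → ⟨ C' , σ' ⟩⟶[ n ]⟨ C'' , σ'' ⟩ →
      ⟨ C , σ ⟩⟶[ suc n ]⟨ C'' , σ'' ⟩

  record Triple : Set where
    constructor ⦅_⦆_⦅_⦆
    field
      pre  : Assn
      prog : Prog
      post : Assn

  data RuleName : Set where
    Axiom Cons Assign Or While : RuleName

  data Instance : RuleName → List Triple → Triple → Set where
    axiom : ∀ {Q} → Instance Axiom [] (⦅ Q ⦆ ε ⦅ Q ⦆)
    cons : ∀ {P P' Q Q' C} → P' ⊨ᵉ P → Q ⊨ᵉ Q' →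
      Instance Cons (⦅ P' ⦆ C ⦅ Q' ⦆ ∷ []) (⦅ P ⦆ C ⦅ Q ⦆)
    assign : ∀ {P Q C x E} →
      Instance Assign (⦅ P ⦆ C ⦅ Q ⦆ ∷ [])
                      (⦅ P [ x ≔ E ] ⦆ ⌜ x ≔ E ⌝ ⨾ C ⦅ Q ⦆)
    or : ∀ {P Q C₀ C₁ C} →
      Instance Or (⦅ P ⦆ C₀ ⨾ C ⦅ Q ⦆ ∷ ⦅ P ⦆ C₁ ⨾ C ⦅ Q ⦆ ∷ [])
                  (⦅ P ⦆ ⌜ C₀ or C₁ ⌝ ⨾ C ⦅ Q ⦆)
    while : ∀ {P Q B C C'} →
      Instance While
        (⦅ ⌈ ¬ᶜ B ⌉ ⇒ᵃ P ⦆ C' ⦅ Q ⦆ ∷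
         ⦅ ⌈ B ⌉ ⇒ᵃ P ⦆ (C ⨾ ⌜ while B ⟳ C ⌝) ⨾ C' ⦅ Q ⦆ ∷ [])
        (⦅ P ⦆ ⌜ while B ⟳ C ⌝ ⨾ C' ⦅ Q ⦆)

{-# OPTIONS --safe #-}
-- Except for Cons, every rule is driven by the first reduction step of the conclusion's
-- program: inverting that step leaves an (n − 1)-step run of one premise's program.  The
-- failure of the precondition transfers along that step by the substitution lemma (Assign)
-- and by the agreement of ⌈ B ⌉ with B (While); for Cons the run is kept and only the two
-- entailments are used.
module Submission where

open import Defs
open import Data.Nat using (ℕ; _≤_; _<_; suc; _≟_)
open import Data.Nat.Properties using (≤-refl; n≤1+n)
open import Data.Bool using (T)
open import Data.Fin using (Fin)
open import Data.Vec using (Vec; []; _∷_)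
open import Data.List using (List)
open import Data.List.Membership.Propositional using (_∈_)
open import Data.List.Relation.Unary.Any using (here; there)
open import Data.Product using (Σ; _×_; _,_)
open import Data.Product.Function.NonDependent.Propositional using (_×-cong_)
import Data.Product.Function.Dependent.Propositional as Σ
open import Data.Sum.Function.Propositional using (_⊎-cong_)
open import Function using (_∘_; _⇔_; mk⇔; Equivalence)
open import Function.Related.Propositional using (≡⇒)
open import Function.Related.TypeIsomorphisms using (¬-cong-⇔; →-cong-⇔)
open import Relation.Nullary using (¬_; yes; no; contradiction)
open import Relation.Binary.PropositionalEquality using (_≡_; _≢_; refl; subst; sym; cong; cong₂)
open CPRHL using (axiom; cons; assign; or; while; whileT; whileF; orL; orR; done)
open Equivalence using (to; from)

module _ (S : Signature) where
  open Signature S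
  open CPRHL S

  mutual
    evalT-⌈⌉e : ∀ {k} e σ (ρ : Fin k → ℕ) → evalT ⌈ e ⌉e σ ρ ≡ evalE e σ
    evalT-⌈⌉e (var x)    σ ρ = refl
    evalT-⌈⌉e (num n)    σ ρ = refl
    evalT-⌈⌉e (app f es) σ ρ = cong ⟦ f ⟧f (evalTs-⌈⌉es es σ ρ)

    evalTs-⌈⌉es : ∀ {k j} (es : Vec Exp j) σ (ρ : Fin k → ℕ) → evalTs ⌈ es ⌉es σ ρ ≡ evalEs es σ
    evalTs-⌈⌉es []       σ ρ = refl
    evalTs-⌈⌉es (e ∷ es) σ ρ = cong₂ _∷_ (evalT-⌈⌉e e σ ρ) (evalTs-⌈⌉es es σ ρ)

  sat-⌈⌉ : ∀ {k} B σ (ρ : Fin k → ℕ) → sat ⌈ B ⌉ σ ρ ⇔ holds B σ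
  sat-⌈⌉ (pred Q es) σ ρ = ≡⇒ (cong (T ∘ ⟦ Q ⟧p) (evalTs-⌈⌉es es σ ρ))
  sat-⌈⌉ (e₁ =ᶜ e₂)  σ ρ = ≡⇒ (cong₂ _≡_ (evalT-⌈⌉e e₁ σ ρ) (evalT-⌈⌉e e₂ σ ρ))
  sat-⌈⌉ (e₁ ≤ᶜ e₂)  σ ρ = ≡⇒ (cong₂ _≤_ (evalT-⌈⌉e e₁ σ ρ) (evalT-⌈⌉e e₂ σ ρ))
  sat-⌈⌉ (¬ᶜ B)      σ ρ = ¬-cong-⇔ (sat-⌈⌉ B σ ρ)
  sat-⌈⌉ (B₁ ∧ᶜ B₂)  σ ρ = sat-⌈⌉ B₁ σ ρ ×-cong sat-⌈⌉ B₂ σ ρ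
  sat-⌈⌉ (B₁ ∨ᶜ B₂)  σ ρ = sat-⌈⌉ B₁ σ ρ ⊎-cong sat-⌈⌉ B₂ σ ρ

  module _ (x : Var) (E : Exp) (σ : State) where
    mutual
      evalT-substT : ∀ {k} (t : Term k) ρ → evalT (substT t x E) σ ρ ≡ evalT t (σ [ x ↦ evalE E σ ]) ρ
      evalT-substT (pvar y) ρ with x ≟ y
      ... | yes _ = evalT-⌈⌉e E σ ρ
      ... | no  _ = refl
      evalT-substT (bvar i)   ρ = refl
      evalT-substT (num n)    ρ = refl
      evalT-substT (app f ts) ρ = cong ⟦ f ⟧f (evalTs-substTs ts ρ)

      evalTs-substTs : ∀ {k j} (ts : Vec (Term k) j) ρ →
                       evalTs (substTs ts x E) σ ρ ≡ evalTs ts (σ [ x ↦ evalE E σ ]) ρ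
      evalTs-substTs []       ρ = refl
      evalTs-substTs (t ∷ ts) ρ = cong₂ _∷_ (evalT-substT t ρ) (evalTs-substTs ts ρ)

    sat-subst : ∀ {k} (φ : Fml k) ρ → sat (φ [ x ≔ E ]) σ ρ ⇔ sat φ (σ [ x ↦ evalE E σ ]) ρ
    sat-subst (pred Q ts) ρ = ≡⇒ (cong (T ∘ ⟦ Q ⟧p) (evalTs-substTs ts ρ))
    sat-subst (t₁ =ᵃ t₂)  ρ = ≡⇒ (cong₂ _≡_ (evalT-substT t₁ ρ) (evalT-substT t₂ ρ))
    sat-subst (t₁ ≤ᵃ t₂)  ρ = ≡⇒ (cong₂ _≤_ (evalT-substT t₁ ρ) (evalT-substT t₂ ρ))
    sat-subst (¬ᵃ φ)      ρ = ¬-cong-⇔ (sat-subst φ ρ)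
    sat-subst (φ ∧ᵃ ψ)    ρ = sat-subst φ ρ ×-cong sat-subst ψ ρ
    sat-subst (φ ∨ᵃ ψ)    ρ = sat-subst φ ρ ⊎-cong sat-subst ψ ρ
    sat-subst (φ ⇒ᵃ ψ)    ρ = →-cong-⇔ (sat-subst φ ρ) (sat-subst ψ ρ)
    sat-subst (∀ᵃ φ)      ρ = mk⇔ (λ h v → to   (sat-subst φ (extend v ρ)) (h v))
                                  (λ h v → from (sat-subst φ (extend v ρ)) (h v))
    sat-subst (∃ᵃ φ)      ρ = Σ.congˡ (sat-subst φ (extend _ ρ))

  ⨾-identityʳ : ∀ C → C ⨾ ε ≡ C
  ⨾-identityʳ ε     = refl
  ⨾-identityʳ ⌜ c ⌝ = refl

  data FirstStep (c : Cmd) (C : Prog) (σ σ' : State) : ℕ → Set where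
    first : ∀ {C₀ σ₁ n} → ⟨ ⌜ c ⌝ , σ ⟩⟶⟨ C₀ , σ₁ ⟩ → ⟨ C₀ ⨾ C , σ₁ ⟩⟶[ n ]⟨ ε , σ' ⟩ →
            FirstStep c C σ σ' (suc n)

  first-step : ∀ {c} C {σ σ' n} → ⟨ ⌜ c ⌝ ⨾ C , σ ⟩⟶[ n ]⟨ ε , σ' ⟩ → FirstStep c C σ σ' n
  first-step ε {σ' = σ'} (step {C' = C₀} s run) =
    first s (subst (λ D → ⟨ D , _ ⟩⟶[ _ ]⟨ ε , σ' ⟩) (sym (⨾-identityʳ C₀)) run)
  first-step ⌜ c₁ ⌝ (step (seq s) run) = first s run

  PremiseCounterexample : RuleName → List Triple → State → ℕ → Set
  PremiseCounterexample r ps σ' n =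
    Σ Triple λ t → t ∈ ps × (σ' ⊨ Triple.post t) ×
      (Σ ℕ λ n' → Σ State λ σ'' →
        n' ≤ n × ¬ (σ'' ⊨ Triple.pre t) ×
        ⟨ Triple.prog t , σ'' ⟩⟶[ n' ]⟨ ε , σ' ⟩ ×
        (r ≢ Cons → n' < n))

  shorter-premise-counterexample : ∀ {r ps t σ'' σ' n} → t ∈ ps → σ' ⊨ Triple.post t →
    ¬ (σ'' ⊨ Triple.pre t) → ⟨ Triple.prog t , σ'' ⟩⟶[ n ]⟨ ε , σ' ⟩ →
    PremiseCounterexample r ps σ' (suc n)
  shorter-premise-counterexample {σ'' = σ''} {n = n} t∈ps σ'⊨Q σ''⊭P run =
    _ , t∈ps , σ'⊨Q , n , σ'' , n≤1+n n , σ''⊭P , run , λ _ → ≤-refl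

lemma4p3 : (S : Signature) → let open CPRHL S in
    ∀ {r : RuleName} {ps : List Triple} {P : Assn} {C : Prog} {Q : Assn} →
    Instance r ps (⦅ P ⦆ C ⦅ Q ⦆) →
    ∀ (n : ℕ) (σ σ' : State) →
    σ' ⊨ Q → ⟨ C , σ ⟩⟶[ n ]⟨ ε , σ' ⟩ → ¬ (σ ⊨ P) →
    Σ Triple λ t → t ∈ ps × (σ' ⊨ Triple.post t) ×
      (Σ ℕ λ n' → Σ State λ σ'' →
        n' ≤ n × ¬ (σ'' ⊨ Triple.pre t) ×
        ⟨ Triple.prog t , σ'' ⟩⟶[ n' ]⟨ ε , σ' ⟩ ×
        (r ≢ Cons → n' < n))
lemma4p3 S axiom _ _ _ σ'⊨Q done σ⊭Q = contradiction σ'⊨Q σ⊭Q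
lemma4p3 S (cons P'⊨P Q⊨Q') n σ σ' σ'⊨Q run σ⊭P =
  _ , here refl , Q⊨Q' σ' σ'⊨Q , n , σ , ≤-refl , σ⊭P ∘ P'⊨P σ , run , λ r≢Cons → contradiction refl r≢Cons
lemma4p3 S (assign {P = P} {C = C} {x = x} {E = E}) _ σ _ σ'⊨Q run σ⊭P with first-step S C run
... | first assign rest =
  shorter-premise-counterexample S (here refl) σ'⊨Q (σ⊭P ∘ from (sat-subst S x E σ P _)) rest
lemma4p3 S (or {C = C}) _ _ _ σ'⊨Q run σ⊭P with first-step S C run
... | first orL rest = shorter-premise-counterexample S (here refl) σ'⊨Q σ⊭P rest
... | first orR rest = shorter-premise-counterexample S (there (here refl)) σ'⊨Q σ⊭P rest
lemma4p3 S (while {B = B} {C' = C'}) _ σ _ σ'⊨Q run σ⊭P with first-step S C' run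
... | first (whileT B-holds) rest =
  shorter-premise-counterexample S (there (here refl)) σ'⊨Q
    (λ B⇒P → σ⊭P (B⇒P (from (sat-⌈⌉ S B σ _) B-holds))) rest
... | first (whileF B-fails) rest =
  shorter-premise-counterexample S (here refl) σ'⊨Q
    (λ ¬B⇒P → σ⊭P (¬B⇒P (B-fails ∘ to (sat-⌈⌉ S B σ _)))) rest
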